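{- Let $(m,n)$ be a coprime pair of positive integers, let $D\in\mathcal D_{m,n}$ and let $\Sigma$ be the $(S,W)$-word of $D$. Let $R=(r_1,r_2,\dots,r_{m+n})$ be a weakly increasing sequence of integers with $r_1=0$. Then $R$ is a rearrangement of the rank sequence of some pre-image $\overline D$ of $D$ under the sweep map if and only if the path diagram $T(\Sigma,R)$ is balanced and $R$ is strictly increasing.
   Context: An $(m,n)$-Dyck path is a lattice path from $(0,0)$ to $(m,n)$ made of $n$ North steps $(0,1)$ and $m$ East steps $(1,0)$ that stays weakly above the line $y=nx/m$; $\mathcal D_{m,n}$ is the set of such paths. The rank of a vertex is computed along the path starting with rank $0$ at $(0,0)$, adding $m$ after each North step and subtracting $n$ after each East step (so $(x,y)$ has rank $my-nx$); a path is an $(m,n)$-Dyck path iff all its ranks are nonnegative. The rank sequence of a path is the sequence of ranks of the starting points of its $m+n$ steps, in order along the path. The $(S,W)$-word of a path is obtained by writing $S$ for each North step and $W$ for each East step, in order. The sweep map sends $\overline D\in\mathcal D_{m,n}$ to the path $D$ whose steps are the steps of $\overline D$ rearranged in increasing order of the ranks of their starting points; $\overline D$ is then called a pre-image of $D$. Path diagram: given a word $\Sigma=\Sigma_1\cdots\Sigma_{m+n}$ in letters $S,W$ and an integer sequence $R=(r_1,\dots,r_{m+n})$, $T(\Sigma,R)$ consists of arrows $A_1,\dots,A_{m+n}$, where $A_i$ goes from $(i-1,r_i)$ to $(i,r_i+m)$ (red) if $\Sigma_i=S$ and from $(i-1,r_i)$ to $(i,r_i-n)$ (blue) if $\Sigma_i=W$.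 For an integer $j$, row $j$ is the strip between $y=j$ and $y=j+1$; a red arrow with starting rank $r$ has a segment in rows $r,\dots,r+m-1$, a blue arrow with starting rank $r$ has a segment in rows $r-n,\dots,r-1$. With $c^r(j)$, $c^b(j)$ the numbers of red, blue arrows having a segment in row $j$, the row count is $c(j)=c^r(j)-c^b(j)$. $T(\Sigma,R)$ is balanced if $c(j)=0$ for every integer $j$. -}

module Defs where

open import Data.Nat using (ℕ; zero; suc; _+_)
open import Data.Integer using (ℤ; +_; _-_; _≤_; _<_; _≤?_; _<?_)
  renaming (_+_ to _+ℤ_)
open import Data.Bool using (Bool; true; false; _∧_; if_then_else_)
open import Data.List using (List; []; _∷_; map; zip; length; filter)
open import Data.List.Relation.Unary.All using (All)
open import Data.List.Relation.Unary.Linked using (Linked)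
open import Data.List.Relation.Binary.Permutation.Propositional using (_↭_)
open import Data.Product using (_×_; proj₁; proj₂; ∃)
open import Relation.Nullary.Decidable using (⌊_⌋)
open import Relation.Binary.PropositionalEquality using (_≡_)

-- Lattice steps: N = North (0,1), E = East (1,0).
data Step : Set where
  N E : Step

data Letter : Set where
  S W : Letter

Path : Set
Path = List Step

letter : Step → Letter
letter N = S
letter E = W

swWord : Path → List Letter
swWord = map letter

countN : Path → ℕ
countN []       = 0
countN (N ∷ p)  = suc (countN p)
countN (E ∷ p)  = countN p

countE : Path → ℕ
countE []       = 0
countE (E ∷ p)  = suc (countE p)
countE (N ∷ p)  = countE p

nextRank : ℕ → ℕ → ℤ → Step → ℤ
nextRank m n r N = r +ℤ (+ m)
nextRank m n r E = r - (+ n)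

vertexRanksFrom : ℕ → ℕ → ℤ → Path → List ℤ
vertexRanksFrom m n r []      = r ∷ []
vertexRanksFrom m n r (s ∷ p) = r ∷ vertexRanksFrom m n (nextRank m n r s) p

startRanksFrom : ℕ → ℕ → ℤ → Path → List ℤ
startRanksFrom m n r []      = []
startRanksFrom m n r (s ∷ p) = r ∷ startRanksFrom m n (nextRank m n r s) p

rankSeq : ℕ → ℕ → Path → List ℤ
rankSeq m n = startRanksFrom m n (+ 0)

IsDyck : ℕ → ℕ → Path → Set
IsDyck m n D = countN D ≡ n × countE D ≡ m × All (λ r → + 0 ≤ r) (vertexRanksFrom m n (+ 0) D)

-- sweep map: D is obtained from Dbar by rearranging its steps in
-- increasing order of the ranks of their starting points.
SweepOf : ℕ → ℕ → Path → Path → Set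
SweepOf m n Dbar D =
  ∃ λ (L : List (ℤ × Step)) →
    L ↭ zip (rankSeq m n Dbar) Dbar
    × Linked (λ a b → proj₁ a ≤ proj₁ b) L
    × map proj₂ L ≡ D

IsPreImage : ℕ → ℕ → Path → Path → Set
IsPreImage m n D Dbar = IsDyck m n Dbar × SweepOf m n Dbar D

-- path diagram T(Σ,R): number of red arrows with a segment in row j
-- (red arrow from rank r covers rows r, …, r+m-1)
redCount : ℕ → List Letter → List ℤ → ℤ → ℕ
redCount m (S ∷ Σ) (r ∷ R) j =
  (if ⌊ r ≤? j ⌋ ∧ ⌊ j <? r +ℤ (+ m) ⌋ then 1 else 0) + redCount m Σ R j
redCount m (W ∷ Σ) (r ∷ R) j = redCount m Σ R j
redCount m _ _ j = 0

-- number of blue arrows with a segment in row j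
-- (blue arrow from rank r covers rows r-n, …, r-1)
blueCount : ℕ → List Letter → List ℤ → ℤ → ℕ
blueCount n (W ∷ Σ) (r ∷ R) j =
  (if ⌊ r - (+ n) ≤? j ⌋ ∧ ⌊ j <? r ⌋ then 1 else 0) + blueCount n Σ R j
blueCount n (S ∷ Σ) (r ∷ R) j = blueCount n Σ R j
blueCount n _ _ j = 0

Balanced : ℕ → ℕ → List Letter → List ℤ → Set
Balanced m n Σ R = ∀ (j : ℤ) → redCount m Σ R j ≡ blueCount n Σ R j

-- Ranks move by + m along a North step and by − n along an East step, so a walk with
-- k North and l East steps changes the rank by k m − l n.  By coprimality a nonempty walk
-- returning to its starting rank has at least m + n steps, hence the m + n start ranks
-- of a Dyck path are distinct.  An arrow of T(Σ,R) covers exactly the rows between its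
-- source and target ranks, so c(j) is the number of target ranks above row j minus the
-- number of source ranks above row j.  If D̄ is a pre-image, the arrows of T(Σ,R) are the
-- steps of D̄, whose target ranks are a permutation of its source ranks: T(Σ,R) is
-- balanced and R, the distinct ranks of D̄ sorted, is strictly increasing.  Conversely,
-- balance puts every target rank into R, so the walk from rank 0 that always takes the
-- step T(Σ,R) assigns to the current rank stays inside R; its m + n start ranks are
-- distinct, hence exhaust R, and this walk is a pre-image.
module Submission where

open import Defs
open import Data.Nat using (ℕ; _+_; _<_)
open import Data.Nat.Coprimality using (Coprime)
open import Data.Integer using (ℤ; +_) renaming (_≤_ to _≤ℤ_; _<_ to _<ℤ_)
open import Data.List using (List; length; head)
open import Data.List.Relation.Unary.Linked using (Linked)
open import Data.List.Relation.Binary.Permutation.Propositional using (_↭_)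
open import Data.Maybe using (just)
open import Data.Product using (_×_; ∃)
open import Function.Bundles using (_⇔_)
open import Relation.Binary.PropositionalEquality using (_≡_)

open import Data.Bool using (_∧_; if_then_else_)
import Data.Integer as ℤ
import Data.Integer.Properties as ℤₚ
open import Data.Integer.Tactic.RingSolver using (solve-∀)
open import Data.List using ([]; _∷_; _++_; _∷ʳ_; map; zip; foldl)
open import Data.List.Membership.Propositional using (_∈_)
open import Data.List.Membership.Propositional.Properties using (∈-∃++; ∈-map⁺)
open import Data.List.Properties using (map-cong-local)
open import Data.List.Relation.Binary.Permutation.Propositional
  using (↭-refl; ↭-sym; ↭-trans; prep; swap; ↭⇒↭ₛ; module PermutationReasoning)
  renaming (refl to ↭-refl′; trans to ↭-trans′)
open import Data.List.Relation.Binary.Permutation.Propositional.Properties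
  using (All-resp-↭; ∈-resp-↭; shift; drop-∷; ↭-length; map⁺; ∷↭∷ʳ)
import Data.List.Relation.Binary.Permutation.Setoid.Properties as ↭ₛ
open import Data.List.Relation.Binary.Pointwise using (Pointwise-≡⇒≡)
open import Data.List.Relation.Unary.All using (All; []; _∷_)
import Data.List.Relation.Unary.All as All
open import Data.List.Relation.Unary.All.Properties using (¬Any⇒All¬; ++⁺)
open import Data.List.Relation.Unary.Any using (here; there)
open import Data.List.Relation.Unary.AllPairs using ([]; _∷_)
import Data.List.Relation.Unary.AllPairs as AllPairs
import Data.List.Relation.Unary.Linked as Linked
import Data.List.Relation.Unary.Linked.Properties as Linked
open import Data.List.Relation.Unary.Sorted.TotalOrder.Properties using (↗↭↗⇒≋)
open import Data.List.Relation.Unary.Unique.Propositional using (Unique)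
open import Data.Nat using (zero; suc; _*_; _≤_; s<s; NonZero; >-nonZero)
import Data.Nat.Properties as ℕₚ
open import Algebra.Properties.CommutativeSemigroup ℕₚ.+-commutativeSemigroup
  using (interchange; x∙yz≈y∙xz)
open import Data.Nat.Coprimality using (coprime-divisor)
import Data.Nat.Coprimality as Coprime
open import Data.Nat.Divisibility using (divides)
open import Data.Product using (_,_; proj₁; proj₂; uncurry)
open import Function using (_∘_)
open import Function.Bundles using (mk⇔; Equivalence)
open import Relation.Binary.PropositionalEquality
  using (_≢_; refl; sym; trans; cong; cong₂; subst; setoid; module ≡-Reasoning)
open import Relation.Nullary using (Dec; yes; no; ¬_; contradiction)
open import Relation.Nullary.Decidable using (⌊_⌋)

map-proj₁-zip : ∀ {A B : Set} (xs : List A) (ys : List B) →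
                length xs ≡ length ys → map proj₁ (zip xs ys) ≡ xs
map-proj₁-zip []       []       _  = refl
map-proj₁-zip (x ∷ xs) (y ∷ ys) eq = cong (x ∷_) (map-proj₁-zip xs ys (ℕₚ.suc-injective eq))

map-proj₂-zip : ∀ {A B : Set} (xs : List A) (ys : List B) →
                length xs ≡ length ys → map proj₂ (zip xs ys) ≡ ys
map-proj₂-zip []       []       _  = refl
map-proj₂-zip (x ∷ xs) (y ∷ ys) eq = cong (y ∷_) (map-proj₂-zip xs ys (ℕₚ.suc-injective eq))

zip-map-proj : ∀ {A B : Set} (ps : List (A × B)) → zip (map proj₁ ps) (map proj₂ ps) ≡ ps
zip-map-proj []       = refl
zip-map-proj (p ∷ ps) = cong (p ∷_) (zip-map-proj ps)

Unique-resp-↭ : ∀ {A : Set} {xs ys : List A} → xs ↭ ys → Unique xs → Unique ys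
Unique-resp-↭ {A} xs↭ys = ↭ₛ.Unique-resp-↭ (setoid A) (↭⇒↭ₛ xs↭ys)

∈-++-∷⁻ : ∀ {A : Set} {v w : A} as {bs} → w ∈ as ++ v ∷ bs → v ≢ w → w ∈ as ++ bs
∈-++-∷⁻ {v = v} as {bs} w∈ v≢w with ∈-resp-↭ (shift v as bs) w∈
... | here w≡v  = contradiction (sym w≡v) v≢w
... | there w∈′ = w∈′

unique-⊆-length⇒↭ : ∀ {A : Set} {xs ys : List A} →
                    Unique xs → All (_∈ ys) xs → length xs ≡ length ys → xs ↭ ys
unique-⊆-length⇒↭ {xs = []} {[]}    _ _ _  = ↭-refl
unique-⊆-length⇒↭ {xs = []} {_ ∷ _} _ _ ()
unique-⊆-length⇒↭ {xs = v ∷ xs} (v∉xs ∷ xs!) (v∈ys ∷ xs⊆ys) |xs|≡|ys| with ∈-∃++ v∈ys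
... | as , bs , refl =
  ↭-trans (prep v (unique-⊆-length⇒↭ xs! xs⊆as++bs |xs|≡|as++bs|)) (↭-sym (shift v as bs))
  where
  xs⊆as++bs : All (_∈ as ++ bs) xs
  xs⊆as++bs = All.zipWith (λ (w∈ , v≢w) → ∈-++-∷⁻ as w∈ v≢w) (xs⊆ys , v∉xs)
  |xs|≡|as++bs| : length xs ≡ length (as ++ bs)
  |xs|≡|as++bs| = ℕₚ.suc-injective (trans |xs|≡|ys| (↭-length (shift v as bs)))

sorted-↭⇒≡ : ∀ {xs ys} → Linked _≤ℤ_ xs → Linked _≤ℤ_ ys → xs ↭ ys → xs ≡ ys
sorted-↭⇒≡ xs↗ ys↗ xs↭ys = Pointwise-≡⇒≡ (↗↭↗⇒≋ ℤₚ.≤-totalOrder xs↗ ys↗ (↭⇒↭ₛ xs↭ys))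

sorted∧unique⇒strict : ∀ {xs} → Linked _≤ℤ_ xs → Unique xs → Linked _<ℤ_ xs
sorted∧unique⇒strict xs↗ xs! = Linked.zipWith (uncurry ℤₚ.≤∧≢⇒<) (xs↗ , Linked.AllPairs⇒Linked xs!)

strict⇒unique : ∀ {xs} → Linked _<ℤ_ xs → Unique xs
strict⇒unique xs↗ = AllPairs.map ℤₚ.<⇒≢ (Linked.Linked⇒AllPairs ℤₚ.<-trans xs↗)

sorted-from-0 : ∀ {xs} → Linked _≤ℤ_ xs → head xs ≡ just (+ 0) → + 0 ∈ xs × All (+ 0 ≤ℤ_) xs
sorted-from-0 {_ ∷ _} xs↗ refl = here refl , Linked.Linked⇒All ℤₚ.≤-trans ℤₚ.≤-refl xs↗

-- N is a junk value for ranks missing from the table.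
stepAt : List (ℤ × Step) → ℤ → Step
stepAt []            v = N
stepAt ((r , s) ∷ T) v = if ⌊ r ℤ.≟ v ⌋ then s else stepAt T v

stepAt-∈ : ∀ T {v} → v ∈ map proj₁ T → (v , stepAt T v) ∈ T
stepAt-∈ ((r , s) ∷ T) {v} v∈ with r ℤ.≟ v | v∈
... | yes refl | _          = here refl
... | no r≢v   | here v≡r   = contradiction (sym v≡r) r≢v
... | no _     | there v∈T  = there (stepAt-∈ T v∈T)

stepAt-here : ∀ r s T → stepAt ((r , s) ∷ T) r ≡ s
stepAt-here r s T with r ℤ.≟ r
... | yes _   = refl
... | no r≢r  = contradiction refl r≢r

stepAt-there : ∀ {r v} s T → r ≢ v → stepAt ((r , s) ∷ T) v ≡ stepAt T v
stepAt-there {r} {v} s T r≢v with r ℤ.≟ v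
... | yes r≡v = contradiction r≡v r≢v
... | no _    = refl

zip≡map-stepAt : ∀ R D → Unique R → length R ≡ length D →
                 zip R D ≡ map (λ r → r , stepAt (zip R D) r) R
zip≡map-stepAt []      []      _            _  = refl
zip≡map-stepAt (r ∷ R) (s ∷ D) (r∉R ∷ R!) eq =
  cong₂ _∷_ (cong (r ,_) (sym (stepAt-here r s (zip R D))))
            (trans (zip≡map-stepAt R D R! (ℕₚ.suc-injective eq))
                   (map-cong-local (All.map (λ r≢v → cong (_ ,_) (sym (stepAt-there s (zip R D) r≢v))) r∉R)))

-- Counting ranks above a row

𝟙 : {P : Set} → Dec P → ℕ
𝟙 P? = if ⌊ P? ⌋ then 1 else 0

countAbove : ℤ → List ℤ → ℕ
countAbove j []       = 0
countAbove j (x ∷ xs) = 𝟙 (j ℤ.<? x) + countAbove j xs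

countEqual : ℤ → List ℤ → ℕ
countEqual t []       = 0
countEqual t (x ∷ xs) = 𝟙 (t ℤ.≟ x) + countEqual t xs

countAbove-↭ : ∀ j {xs ys} → xs ↭ ys → countAbove j xs ≡ countAbove j ys
countAbove-↭ j ↭-refl′         = refl
countAbove-↭ j (prep x p)      = cong (_+_ (𝟙 (j ℤ.<? x))) (countAbove-↭ j p)
countAbove-↭ j {x ∷ y ∷ xs} (swap x y p) =
  trans (x∙yz≈y∙xz (𝟙 (j ℤ.<? x)) (𝟙 (j ℤ.<? y)) (countAbove j xs))
        (cong (λ k → 𝟙 (j ℤ.<? y) + (𝟙 (j ℤ.<? x) + k)) (countAbove-↭ j p))
countAbove-↭ j (↭-trans′ p q)  = trans (countAbove-↭ j p) (countAbove-↭ j q)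

𝟙-pred< : ∀ t x → 𝟙 (ℤ.pred t ℤ.<? x) ≡ 𝟙 (t ℤ.<? x) + 𝟙 (t ℤ.≟ x)
𝟙-pred< t x with t ℤ.≟ x | t ℤ.<? x | ℤ.pred t ℤ.<? x
... | yes refl | yes t<t | _       = contradiction refl (ℤₚ.<⇒≢ t<t)
... | yes refl | no _    | yes _   = refl
... | yes refl | no _    | no t≮t  = contradiction (ℤₚ.i≤pred[j]⇒i<j ℤₚ.≤-refl) t≮t
... | no _     | yes _   | yes _   = refl
... | no _     | yes t<x | no t≮x  = contradiction (ℤₚ.≤-<-trans (ℤₚ.i≤j⇒pred[i]≤j ℤₚ.≤-refl) t<x) t≮x
... | no t≢x   | no t≮x  | yes t<x = contradiction (ℤₚ.≤∧≢⇒< t≤x t≢x) t≮x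
  where
  t≤x : t ≤ℤ x
  t≤x = subst (_≤ℤ x) (ℤₚ.suc-pred t) (ℤₚ.i<j⇒suc[i]≤j t<x)
... | no _     | no _    | no _    = refl

countAbove-pred : ∀ t xs → countAbove (ℤ.pred t) xs ≡ countAbove t xs + countEqual t xs
countAbove-pred t []       = refl
countAbove-pred t (x ∷ xs) =
  trans (cong₂ _+_ (𝟙-pred< t x) (countAbove-pred t xs))
        (interchange (𝟙 (t ℤ.<? x)) (𝟙 (t ℤ.≟ x)) (countAbove t xs) (countEqual t xs))

∈⇒0<countEqual : ∀ {t xs} → t ∈ xs → 0 < countEqual t xs
∈⇒0<countEqual {t} (here refl) with t ℤ.≟ t
... | yes _   = ℕₚ.0<1+n
... | no t≢t  = contradiction refl t≢t
∈⇒0<countEqual (there t∈xs) = ℕₚ.<-≤-trans (∈⇒0<countEqual t∈xs) (ℕₚ.m≤n+m _ _)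

0<countEqual⇒∈ : ∀ {t} xs → 0 < countEqual t xs → t ∈ xs
0<countEqual⇒∈ {t} (x ∷ xs) pos with t ℤ.≟ x
... | yes t≡x = here t≡x
... | no _    = there (0<countEqual⇒∈ xs pos)

-- The multiplicity of t is the count above row pred t minus the count above row t.
countAbove-≗⇒⊇ : ∀ {xs ys} → (∀ j → countAbove j xs ≡ countAbove j ys) → ∀ {t} → t ∈ ys → t ∈ xs
countAbove-≗⇒⊇ {xs} {ys} same {t} t∈ys =
  0<countEqual⇒∈ xs (subst (0 <_) (sym equal) (∈⇒0<countEqual t∈ys))
  where
  equal : countEqual t xs ≡ countEqual t ys
  equal = ℕₚ.+-cancelˡ-≡ (countAbove t xs) _ _ (begin
    countAbove t xs + countEqual t xs  ≡⟨ sym (countAbove-pred t xs) ⟩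
    countAbove (ℤ.pred t) xs           ≡⟨ same (ℤ.pred t) ⟩
    countAbove (ℤ.pred t) ys           ≡⟨ countAbove-pred t ys ⟩
    countAbove t ys + countEqual t ys  ≡⟨ cong (_+ countEqual t ys) (sym (same t)) ⟩
    countAbove t xs + countEqual t ys  ∎)
    where open ≡-Reasoning

-- An arrow between ranks a ≤ b covers the rows j with a ≤ j < b.
segment-𝟙 : ∀ {a b} j → a ≤ℤ b →
            (if ⌊ a ℤ.≤? j ⌋ ∧ ⌊ j ℤ.<? b ⌋ then 1 else 0) + 𝟙 (j ℤ.<? a) ≡ 𝟙 (j ℤ.<? b)
segment-𝟙 {a} {b} j a≤b with a ℤ.≤? j | j ℤ.<? b | j ℤ.<? a
... | yes a≤j | _      | yes j<a = contradiction a≤j (ℤₚ.<⇒≱ j<a)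
... | yes _   | yes _  | no _    = refl
... | yes _   | no _   | no _    = refl
... | no _    | yes _  | yes _   = refl
... | no _    | no j≮b | yes j<a = contradiction (ℤₚ.<-≤-trans j<a a≤b) j≮b
... | no a≰j  | _      | no j≮a  = contradiction (ℤₚ.≰⇒> a≰j) j≮a

-- Ranks along a path

-- If a m = b n with m, n coprime, then (a, b) = q (n, m) for some q.
coprime-multiples : ∀ {m n a b} .{{_ : NonZero n}} → Coprime m n →
                    a * m ≡ b * n → 0 < a + b → m + n ≤ a + b
coprime-multiples {m} {n} {a} {b} coprime am≡bn 0<a+b
  with coprime-divisor (Coprime.sym coprime) (divides b (trans (ℕₚ.*-comm m a) am≡bn))
... | divides q a≡qn =
  subst (m + n ≤_) (sym a+b≡q[m+n]) (m+n≤k[m+n] q (subst (0 <_) a+b≡q[m+n] 0<a+b))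
  where
  open ≡-Reasoning
  b≡qm : b ≡ q * m
  b≡qm = ℕₚ.*-cancelʳ-≡ b (q * m) n (begin
    b * n        ≡⟨ sym am≡bn ⟩
    a * m        ≡⟨ cong (_* m) a≡qn ⟩
    q * n * m    ≡⟨ ℕₚ.*-assoc q n m ⟩
    q * (n * m)  ≡⟨ cong (q *_) (ℕₚ.*-comm n m) ⟩
    q * (m * n)  ≡⟨ ℕₚ.*-assoc q m n ⟨
    q * m * n    ∎)
  a+b≡q[m+n] : a + b ≡ q * (m + n)
  a+b≡q[m+n] = begin
    a + b          ≡⟨ cong₂ _+_ a≡qn b≡qm ⟩
    q * n + q * m  ≡⟨ ℕₚ.+-comm (q * n) (q * m) ⟩
    q * m + q * n  ≡⟨ ℕₚ.*-distribˡ-+ q m n ⟨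
    q * (m + n)    ∎
  m+n≤k[m+n] : ∀ k → 0 < k * (m + n) → m + n ≤ k * (m + n)
  m+n≤k[m+n] (suc k) _ = ℕₚ.m≤m+n (m + n) (k * (m + n))

countN-↭ : ∀ {p q} → p ↭ q → countN p ≡ countN q
countN-↭ ↭-refl′         = refl
countN-↭ (prep N r)      = cong suc (countN-↭ r)
countN-↭ (prep E r)      = countN-↭ r
countN-↭ (swap N N r)    = cong (suc ∘ suc) (countN-↭ r)
countN-↭ (swap N E r)    = cong suc (countN-↭ r)
countN-↭ (swap E N r)    = cong suc (countN-↭ r)
countN-↭ (swap E E r)    = countN-↭ r
countN-↭ (↭-trans′ r s)  = trans (countN-↭ r) (countN-↭ s)

countE-↭ : ∀ {p q} → p ↭ q → countE p ≡ countE q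
countE-↭ ↭-refl′         = refl
countE-↭ (prep E r)      = cong suc (countE-↭ r)
countE-↭ (prep N r)      = countE-↭ r
countE-↭ (swap E E r)    = cong (suc ∘ suc) (countE-↭ r)
countE-↭ (swap E N r)    = cong suc (countE-↭ r)
countE-↭ (swap N E r)    = cong suc (countE-↭ r)
countE-↭ (swap N N r)    = countE-↭ r
countE-↭ (↭-trans′ r s)  = trans (countE-↭ r) (countE-↭ s)

length≡countN+countE : ∀ p → length p ≡ countN p + countE p
length≡countN+countE []      = refl
length≡countN+countE (N ∷ p) = cong suc (length≡countN+countE p)
length≡countN+countE (E ∷ p) =
  trans (cong suc (length≡countN+countE p)) (sym (ℕₚ.+-suc (countN p) (countE p)))

module _ (m n : ℕ) where

  endRank : ℤ → Path → ℤ
  endRank = foldl (nextRank m n)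

  target : ℤ × Step → ℤ
  target = uncurry (nextRank m n)

  endRank-formula : ∀ r p → endRank r p ≡ r ℤ.+ + countN p ℤ.* + m ℤ.- + countE p ℤ.* + n
  endRank-formula r []      = no-steps r (+ m) (+ n)
    where
    no-steps : ∀ r a b → r ≡ r ℤ.+ ℤ.0ℤ ℤ.* a ℤ.- ℤ.0ℤ ℤ.* b
    no-steps = solve-∀
  -- The ring identities below match the goals because ℤ.1ℤ ℤ.+ + k reduces to + suc k.
  endRank-formula r (N ∷ p) =
    trans (endRank-formula (r ℤ.+ + m) p) (north-step r (+ countN p) (+ countE p) (+ m) (+ n))
    where
    north-step : ∀ r x y a b → r ℤ.+ a ℤ.+ x ℤ.* a ℤ.- y ℤ.* b ≡ r ℤ.+ (ℤ.1ℤ ℤ.+ x) ℤ.* a ℤ.- y ℤ.* b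
    north-step = solve-∀
  endRank-formula r (E ∷ p) =
    trans (endRank-formula (r ℤ.- + n) p) (east-step r (+ countN p) (+ countE p) (+ m) (+ n))
    where
    east-step : ∀ r x y a b → r ℤ.- b ℤ.+ x ℤ.* a ℤ.- y ℤ.* b ≡ r ℤ.+ x ℤ.* a ℤ.- (ℤ.1ℤ ℤ.+ y) ℤ.* b
    east-step = solve-∀

  length-startRanksFrom : ∀ r p → length (startRanksFrom m n r p) ≡ length p
  length-startRanksFrom r []      = refl
  length-startRanksFrom r (s ∷ p) = cong suc (length-startRanksFrom (nextRank m n r s) p)

  length-dyck : ∀ p → countN p ≡ n → countE p ≡ m → length p ≡ m + n
  length-dyck p cN cE = trans (length≡countN+countE p) (trans (cong₂ _+_ cN cE) (ℕₚ.+-comm n m))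

  vertexRanks-init : ∀ r p → vertexRanksFrom m n r p ≡ startRanksFrom m n r p ∷ʳ endRank r p
  vertexRanks-init r []      = refl
  vertexRanks-init r (s ∷ p) = cong (r ∷_) (vertexRanks-init (nextRank m n r s) p)

  vertexRanks-targets : ∀ r p → vertexRanksFrom m n r p ≡ r ∷ map target (zip (startRanksFrom m n r p) p)
  vertexRanks-targets r []      = refl
  vertexRanks-targets r (s ∷ p) = cong (r ∷_) (vertexRanks-targets (nextRank m n r s) p)

  targets-↭-startRanks : ∀ r p → endRank r p ≡ r →
                         map target (zip (startRanksFrom m n r p) p) ↭ startRanksFrom m n r p
  targets-↭-startRanks r p closed = drop-∷ (begin
    r ∷ map target (zip starts p)  ≡⟨ vertexRanks-targets r p ⟨
    vertexRanksFrom m n r p        ≡⟨ vertexRanks-init r p ⟩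
    starts ∷ʳ endRank r p          ≡⟨ cong (starts ∷ʳ_) closed ⟩
    starts ∷ʳ r                    ↭⟨ ∷↭∷ʳ r starts ⟨
    r ∷ starts                     ∎)
    where
    open PermutationReasoning
    starts : List ℤ
    starts = startRanksFrom m n r p

  dyck-closed : ∀ r p → countN p ≡ n → countE p ≡ m → endRank r p ≡ r
  dyck-closed r p cN cE = begin
    endRank r p                                      ≡⟨ endRank-formula r p ⟩
    r ℤ.+ + countN p ℤ.* + m ℤ.- + countE p ℤ.* + n  ≡⟨ cong₂ (λ x y → r ℤ.+ + x ℤ.* + m ℤ.- + y ℤ.* + n) cN cE ⟩
    r ℤ.+ + n ℤ.* + m ℤ.- + m ℤ.* + n                ≡⟨ cancel r (+ n) (+ m) ⟩
    r                                                ∎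
    where
    open ≡-Reasoning
    cancel : ∀ r a b → r ℤ.+ a ℤ.* b ℤ.- b ℤ.* a ≡ r
    cancel = solve-∀

  closed⇒counts : ∀ r p → endRank r p ≡ r → countN p * m ≡ countE p * n
  closed⇒counts r p closed = ℤₚ.+-injective (begin
    + (countN p * m)        ≡⟨ ℤₚ.pos-* (countN p) m ⟩
    + countN p ℤ.* + m      ≡⟨ ℤₚ.i-j≡0⇒i≡j _ _ (trans (difference r _ _) (ℤₚ.i≡j⇒i-j≡0 r+x-y≡r)) ⟩
    + countE p ℤ.* + n      ≡⟨ ℤₚ.pos-* (countE p) n ⟨
    + (countE p * n)        ∎)
    where
    open ≡-Reasoning
    r+x-y≡r : r ℤ.+ + countN p ℤ.* + m ℤ.- + countE p ℤ.* + n ≡ r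
    r+x-y≡r = trans (sym (endRank-formula r p)) closed
    difference : ∀ r x y → x ℤ.- y ≡ r ℤ.+ x ℤ.- y ℤ.- r
    difference = solve-∀

  closed⇒m+n≤length : .{{_ : NonZero n}} → Coprime m n →
                      ∀ r p → endRank r p ≡ r → 0 < length p → m + n ≤ length p
  closed⇒m+n≤length coprime r p closed 0<|p| =
    subst (m + n ≤_) (sym |p|≡N+E)
      (coprime-multiples {a = countN p} {b = countE p} coprime
        (closed⇒counts r p closed) (subst (0 <_) |p|≡N+E 0<|p|))
    where
    |p|≡N+E : length p ≡ countN p + countE p
    |p|≡N+E = length≡countN+countE p

  ∈-startRanksFrom : ∀ {x} r p → x ∈ startRanksFrom m n r p → ∃ λ q → length q < length p × endRank r q ≡ x
  ∈-startRanksFrom r (s ∷ p) (here refl) = [] , ℕₚ.0<1+n , refl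
  ∈-startRanksFrom r (s ∷ p) (there x∈)  with ∈-startRanksFrom (nextRank m n r s) p x∈
  ... | q , |q|<|p| , reached = s ∷ q , s<s |q|<|p| , reached

  startRanksFrom-unique : .{{_ : NonZero n}} → Coprime m n →
                          ∀ r p → length p ≤ m + n → Unique (startRanksFrom m n r p)
  startRanksFrom-unique coprime r []      _           = []
  startRanksFrom-unique coprime r (s ∷ p) |s∷p|≤m+n =
    ¬Any⇒All¬ _ r∉ ∷ startRanksFrom-unique coprime (nextRank m n r s) p (ℕₚ.<⇒≤ |s∷p|≤m+n)
    where
    r∉ : ¬ r ∈ startRanksFrom m n (nextRank m n r s) p
    r∉ r∈ with ∈-startRanksFrom (nextRank m n r s) p r∈
    ... | q , |q|<|p| , closed = ℕₚ.<⇒≱ (ℕₚ.<-≤-trans (s<s |q|<|p|) |s∷p|≤m+n)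
                                        (closed⇒m+n≤length coprime r (s ∷ q) closed ℕₚ.0<1+n)

  rowCount-identity : ∀ D R j →
    redCount m (swWord D) R j + countAbove j (map proj₁ (zip R D))
      ≡ blueCount n (swWord D) R j + countAbove j (map target (zip R D))
  rowCount-identity []      []      j = refl
  rowCount-identity []      (_ ∷ _) j = refl
  rowCount-identity (N ∷ _) []      j = refl
  rowCount-identity (E ∷ _) []      j = refl
  rowCount-identity (N ∷ D) (r ∷ R) j = begin
    (covered + red) + (𝟙 (j ℤ.<? r) + sources)   ≡⟨ interchange covered red _ sources ⟩
    (covered + 𝟙 (j ℤ.<? r)) + (red + sources)   ≡⟨ cong₂ _+_ (segment-𝟙 j (ℤₚ.i≤i+j r (+ m))) (rowCount-identity D R j) ⟩
    𝟙 (j ℤ.<? r ℤ.+ + m) + (blue + targets)      ≡⟨ x∙yz≈y∙xz _ blue targets ⟩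
    blue + (𝟙 (j ℤ.<? r ℤ.+ + m) + targets)      ∎
    where
    open ≡-Reasoning
    covered : ℕ
    covered = if ⌊ r ℤ.≤? j ⌋ ∧ ⌊ j ℤ.<? r ℤ.+ + m ⌋ then 1 else 0
    red : ℕ
    red = redCount m (swWord D) R j
    blue : ℕ
    blue = blueCount n (swWord D) R j
    sources : ℕ
    sources = countAbove j (map proj₁ (zip R D))
    targets : ℕ
    targets = countAbove j (map target (zip R D))
  rowCount-identity (E ∷ D) (r ∷ R) j = begin
    red + (𝟙 (j ℤ.<? r) + sources)                 ≡⟨ x∙yz≈y∙xz red _ sources ⟩
    𝟙 (j ℤ.<? r) + (red + sources)                 ≡⟨ cong₂ _+_ (sym (segment-𝟙 j (ℤₚ.i-j≤i r (+ n)))) (rowCount-identity D R j) ⟩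
    (covered + 𝟙 (j ℤ.<? r ℤ.- + n)) + (blue + targets)  ≡⟨ interchange covered _ blue targets ⟩
    (covered + blue) + (𝟙 (j ℤ.<? r ℤ.- + n) + targets)  ∎
    where
    open ≡-Reasoning
    covered : ℕ
    covered = if ⌊ r ℤ.- + n ℤ.≤? j ⌋ ∧ ⌊ j ℤ.<? r ⌋ then 1 else 0
    red : ℕ
    red = redCount m (swWord D) R j
    blue : ℕ
    blue = blueCount n (swWord D) R j
    sources : ℕ
    sources = countAbove j (map proj₁ (zip R D))
    targets : ℕ
    targets = countAbove j (map target (zip R D))

  balanced⇔countAbove-sources≡targets : ∀ D R →
    Balanced m n (swWord D) R
      ⇔ (∀ j → countAbove j (map proj₁ (zip R D)) ≡ countAbove j (map target (zip R D)))
  balanced⇔countAbove-sources≡targets D R = mk⇔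
    (λ balanced j → ℕₚ.+-cancelˡ-≡ (redCount m (swWord D) R j) _ _
       (trans (rowCount-identity D R j) (cong (_+ countAbove j (map target (zip R D))) (sym (balanced j)))))
    (λ same j → ℕₚ.+-cancelʳ-≡ _ _ _
       (trans (rowCount-identity D R j) (cong (_+_ (blueCount n (swWord D) R j)) (sym (same j)))))

  walk : List (ℤ × Step) → ℕ → ℤ → Path
  walk T zero    v = []
  walk T (suc k) v = stepAt T v ∷ walk T k (target (v , stepAt T v))

  length-walk : ∀ T k v → length (walk T k v) ≡ k
  length-walk T zero    v = refl
  length-walk T (suc k) v = cong suc (length-walk T k _)

  zip-walk : ∀ T k v → zip (startRanksFrom m n v (walk T k v)) (walk T k v)
                       ≡ map (λ r → r , stepAt T r) (startRanksFrom m n v (walk T k v))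
  zip-walk T zero    v = refl
  zip-walk T (suc k) v = cong ((v , stepAt T v) ∷_) (zip-walk T k _)

  walk-⊆ : ∀ T {R} → (∀ {v} → v ∈ R → target (v , stepAt T v) ∈ R) →
           ∀ k {v} → v ∈ R → All (_∈ R) (startRanksFrom m n v (walk T k v))
  walk-⊆ T closed zero    v∈R = []
  walk-⊆ T closed (suc k) v∈R = v∈R ∷ walk-⊆ T closed k (closed v∈R)

  balanced⇒step-closed : ∀ D R → length R ≡ length D → Balanced m n (swWord D) R →
                         ∀ {v} → v ∈ R → target (v , stepAt (zip R D) v) ∈ R
  balanced⇒step-closed D R |R|≡|D| balanced v∈R =
    countAbove-≗⇒⊇ (λ j → trans (cong (countAbove j) R≡sources)
                                (Equivalence.to (balanced⇔countAbove-sources≡targets D R) balanced j))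
                   (∈-map⁺ target (stepAt-∈ (zip R D) (subst (_ ∈_) R≡sources v∈R)))
    where
    R≡sources : R ≡ map proj₁ (zip R D)
    R≡sources = sym (map-proj₁-zip R D |R|≡|D|)

  walk-startRanks-↭ : .{{_ : NonZero n}} → Coprime m n → ∀ T {R} →
                      (∀ {v} → v ∈ R → target (v , stepAt T v) ∈ R) → + 0 ∈ R → length R ≡ m + n →
                      rankSeq m n (walk T (m + n) (+ 0)) ↭ R
  walk-startRanks-↭ coprime T closed 0∈R |R|≡m+n = unique-⊆-length⇒↭
    (startRanksFrom-unique coprime (+ 0) Dbar (ℕₚ.≤-reflexive |Dbar|≡m+n))
    (walk-⊆ T closed (m + n) 0∈R)
    (trans (length-startRanksFrom (+ 0) Dbar) (trans |Dbar|≡m+n (sym |R|≡m+n)))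
    where
    Dbar : Path
    Dbar = walk T (m + n) (+ 0)
    |Dbar|≡m+n : length Dbar ≡ m + n
    |Dbar|≡m+n = length-walk T (m + n) (+ 0)

  preimage⇒balanced∧strict : .{{_ : NonZero n}} → Coprime m n →
    ∀ D R → countN D ≡ n → countE D ≡ m → length R ≡ m + n → Linked _≤ℤ_ R →
    ∃ (λ Dbar → IsPreImage m n D Dbar × R ↭ rankSeq m n Dbar) →
    Balanced m n (swWord D) R × Linked _<ℤ_ R
  preimage⇒balanced∧strict coprime D R cN cE |R|≡m+n R↗
    (Dbar , ((cN′ , cE′ , _) , L , L↭arrows , L↗ , L₂≡D) , R↭V) =
    Equivalence.from (balanced⇔countAbove-sources≡targets D R) (λ j → countAbove-↭ j sources↭targets) ,
    sorted∧unique⇒strict R↗ (Unique-resp-↭ (↭-sym R↭V) V!)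
    where
    open PermutationReasoning
    V : List ℤ
    V = rankSeq m n Dbar
    |V|≡|Dbar| : length V ≡ length Dbar
    |V|≡|Dbar| = length-startRanksFrom (+ 0) Dbar
    |R|≡|D| : length R ≡ length D
    |R|≡|D| = trans |R|≡m+n (sym (length-dyck D cN cE))

    V! : Unique V
    V! = startRanksFrom-unique coprime (+ 0) Dbar (ℕₚ.≤-reflexive (length-dyck Dbar cN′ cE′))

    L₁≡R : map proj₁ L ≡ R
    L₁≡R = sorted-↭⇒≡ (Linked.map⁺ L↗) R↗ (begin
      map proj₁ L               ↭⟨ map⁺ proj₁ L↭arrows ⟩
      map proj₁ (zip V Dbar)    ≡⟨ map-proj₁-zip V Dbar |V|≡|Dbar| ⟩
      V                         ↭⟨ R↭V ⟨
      R                         ∎)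

    L≡zipRD : L ≡ zip R D
    L≡zipRD = trans (sym (zip-map-proj L)) (cong₂ zip L₁≡R L₂≡D)

    sources↭targets : map proj₁ (zip R D) ↭ map target (zip R D)
    sources↭targets = begin
      map proj₁ (zip R D)       ≡⟨ map-proj₁-zip R D |R|≡|D| ⟩
      R                         ↭⟨ R↭V ⟩
      V                         ↭⟨ targets-↭-startRanks (+ 0) Dbar (dyck-closed (+ 0) Dbar cN′ cE′) ⟨
      map target (zip V Dbar)   ↭⟨ map⁺ target L↭arrows ⟨
      map target L              ≡⟨ cong (map target) L≡zipRD ⟩
      map target (zip R D)      ∎

  balanced∧strict⇒preimage : .{{_ : NonZero n}} → Coprime m n →
    ∀ D R → countN D ≡ n → countE D ≡ m → length R ≡ m + n → Linked _≤ℤ_ R →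
    + 0 ∈ R → All (+ 0 ≤ℤ_) R →
    Balanced m n (swWord D) R × Linked _<ℤ_ R →
    ∃ (λ Dbar → IsPreImage m n D Dbar × R ↭ rankSeq m n Dbar)
  balanced∧strict⇒preimage coprime D R cN cE |R|≡m+n R↗ 0∈R R≥0 (balanced , R-strict) =
    Dbar , ((cN′ , cE′ , Dbar≥0) , arrows , arrows↭ , arrows↗ , map-proj₂-zip R D |R|≡|D|) , ↭-sym V↭R
    where
    open PermutationReasoning
    arrows : List (ℤ × Step)
    arrows = zip R D
    Dbar : Path
    Dbar = walk arrows (m + n) (+ 0)
    V : List ℤ
    V = rankSeq m n Dbar
    |R|≡|D| : length R ≡ length D
    |R|≡|D| = trans |R|≡m+n (sym (length-dyck D cN cE))
    |V|≡|Dbar| : length V ≡ length Dbar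
    |V|≡|Dbar| = length-startRanksFrom (+ 0) Dbar
    R≡sources : R ≡ map proj₁ arrows
    R≡sources = sym (map-proj₁-zip R D |R|≡|D|)

    V↭R : V ↭ R
    V↭R = walk-startRanks-↭ coprime arrows (balanced⇒step-closed D R |R|≡|D| balanced) 0∈R |R|≡m+n

    arrows↭ : arrows ↭ zip V Dbar
    arrows↭ = begin
      arrows                              ≡⟨ zip≡map-stepAt R D (strict⇒unique R-strict) |R|≡|D| ⟩
      map (λ r → r , stepAt arrows r) R   ↭⟨ map⁺ (λ r → r , stepAt arrows r) V↭R ⟨
      map (λ r → r , stepAt arrows r) V   ≡⟨ zip-walk arrows (m + n) (+ 0) ⟨
      zip V Dbar                          ∎

    arrows↗ : Linked (λ a b → proj₁ a ≤ℤ proj₁ b) arrows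
    arrows↗ = Linked.map⁻ (subst (Linked _≤ℤ_) R≡sources R↗)

    Dbar↭D : Dbar ↭ D
    Dbar↭D = begin
      Dbar                      ≡⟨ map-proj₂-zip V Dbar |V|≡|Dbar| ⟨
      map proj₂ (zip V Dbar)    ↭⟨ map⁺ proj₂ arrows↭ ⟨
      map proj₂ arrows          ≡⟨ map-proj₂-zip R D |R|≡|D| ⟩
      D                         ∎

    cN′ : countN Dbar ≡ n
    cN′ = trans (countN-↭ Dbar↭D) cN
    cE′ : countE Dbar ≡ m
    cE′ = trans (countE-↭ Dbar↭D) cE

    Dbar≥0 : All (+ 0 ≤ℤ_) (vertexRanksFrom m n (+ 0) Dbar)
    Dbar≥0 = subst (All (+ 0 ≤ℤ_)) (sym (vertexRanks-init (+ 0) Dbar))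
      (++⁺ (All-resp-↭ (↭-sym V↭R) R≥0) (ℤₚ.≤-reflexive (sym (dyck-closed (+ 0) Dbar cN′ cE′)) ∷ []))

theorem1 : (m n : ℕ) → 0 < m → 0 < n → Coprime m n →
    (D : Path) → IsDyck m n D →
    (R : List ℤ) → length R ≡ m + n → Linked _≤ℤ_ R → head R ≡ just (+ 0) →
    (∃ (λ Dbar → IsPreImage m n D Dbar × R ↭ rankSeq m n Dbar))
      ⇔ (Balanced m n (swWord D) R × Linked _<ℤ_ R)
theorem1 m n _ 0<n coprime D (cN , cE , _) R |R|≡m+n R↗ R₀≡0 =
  mk⇔ (preimage⇒balanced∧strict m n coprime D R cN cE |R|≡m+n R↗)
      (balanced∧strict⇒preimage m n coprime D R cN cE |R|≡m+n R↗ 0∈R R≥0)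
  where
  instance
    n≢0 : NonZero n
    n≢0 = >-nonZero 0<n
  0∈R : + 0 ∈ R
  0∈R = proj₁ (sorted-from-0 R↗ R₀≡0)
  R≥0 : All (+ 0 ≤ℤ_) R
  R≥0 = proj₂ (sorted-from-0 R↗ R₀≡0)
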